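{- Let $q\ge 5$ be a prime power and let $\mathcal{B}$ be a minimal blocking set in $\mathrm{PG}(2,q)$ built with a $k$-construction, where $2q\le k\le 3q-5$. Then $\mathcal{B}$ has the $r_\infty$-property with respect to some point $P\in\mathcal{B}$, and $\mathcal{B}$ is not a blocking semioval.
   Context: A blocking set of $\mathrm{PG}(2,q)$ is a set of points meeting every line and containing no line; minimal if no proper subset is a blocking set. A line is tangent to a point set $\mathcal{K}$ if it meets $\mathcal{K}$ in exactly one point, secant if in more than one. $\mathcal{B}$ has the $r_\infty$-property with respect to $P\in\mathcal{B}$ if exactly one line through $P$ is tangent to $\mathcal{B}$ and all other lines through $P$ are secants. A semioval is a point set $\mathcal{K}$ such that through each point of $\mathcal{K}$ there is exactly one tangent line to $\mathcal{K}$; a blocking semioval is a blocking set which is a semioval. $k$-construction (for $q\ge4$): let $a,b,c$ be non-concurrent lines, $C=a\cap b$, $B=a\cap c$, $A=b\cap c$, and let $\mathcal{T}$ be the vertexless triangle (points on exactly one of $a,b,c$; $|\mathcal{T}|=3q-3$). Choose a line $\ell$ through $A$ different from $b,c$, put $A'=\ell\cap a$, and choose $D_1\in\ell\setminus\{A,A'\}$. Put $B_1=BD_1\cap b$. If $q$ is odd, let $D_2=CC_2\cap\ell$ where $C_2=A'B_1\cap c$; if $q$ is even, choose $D_2\in\ell\setminus\{A,A',D_1\}$. Choose further distinct points $D_3,\dots,D_n\in\ell\setminus\{A,A'\}$ different from $D_1,D_2$, with $2\le n\le q-2$. For each $i$ let $B_i=BD_i\cap b$ and $C_i=CD_i\cap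 c$. Then $\mathcal{B}=(\mathcal{T}\cup\{D_1,\dots,D_n\})\setminus\{B_1,\dots,B_n,C_1,\dots,C_n\}$ is a minimal blocking set of size $k=3q-3-n$, and it is said to be built with a $k$-construction ($2q-1\le k\le 3q-5$). -}

module Defs where

open import Level using (0ℓ)
open import Data.Nat using (ℕ; zero; suc; _^_)
open import Data.Nat.Primality using (Prime)
open import Data.Nat.Divisibility using (_∣_)
open import Data.Fin using (Fin)
import Data.Fin as Fin
open import Data.Product using (Σ; ∃; ∃-syntax; _×_; _,_)
open import Data.Sum using (_⊎_)
open import Relation.Nullary using (¬_; Dec)
open import Relation.Binary.PropositionalEquality using (_≡_)
open import Algebra.Bundles using (CommutativeRing)

IsPrimePower : ℕ → Set
IsPrimePower q = Σ ℕ λ p → Σ ℕ λ e → Prime p × q ≡ p ^ suc e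

record FiniteField (q : ℕ) : Set₁ where
  field
    ring : CommutativeRing 0ℓ 0ℓ
  open CommutativeRing ring
  field
    _≟_      : (x y : Carrier) → Dec (x ≈ y)
    0≉1      : ¬ (0# ≈ 1#)
    inverse  : (x : Carrier) → ¬ (x ≈ 0#) → Σ Carrier λ y → x * y ≈ 1#
    enum     : Fin q → Carrier
    enum-inj : (i j : Fin q) → enum i ≈ enum j → i ≡ j
    enum-sur : (x : Carrier) → Σ (Fin q) λ i → enum i ≈ x

-- Points and lines are both represented by non-zero vectors of F^3 (up to
-- non-zero scalar multiples); point P lies on line L iff P·L = 0.
module PG {q : ℕ} (F : FiniteField q) where
  open FiniteField F
  open CommutativeRing ring

  record V3 : Set where
    constructor ⟨_,_,_⟩
    field
      x y z : Carrier
  open V3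

  NZ : V3 → Set
  NZ v = ¬ ((x v ≈ 0#) × (y v ≈ 0#) × (z v ≈ 0#))

  _∼_ : V3 → V3 → Set
  u ∼ v = Σ Carrier λ t → ¬ (t ≈ 0#) ×
            ((x u ≈ t * x v) × (y u ≈ t * y v) × (z u ≈ t * z v))

  dot : V3 → V3 → Carrier
  dot u v = x u * x v + y u * y v + z u * z v

  _on_ : V3 → V3 → Set
  P on L = dot P L ≈ 0#

  -- cross product: line through two distinct points / intersection point of
  -- two distinct lines
  _⊗_ : V3 → V3 → V3
  u ⊗ v = ⟨ y u * z v - z u * y v , z u * x v - x u * z v , x u * y v - y u * x v ⟩

  PointSet : Set₁
  PointSet = V3 → Set

  Respects∼ : PointSet → Set
  Respects∼ K = ∀ u v → NZ u → NZ v → u ∼ v → K u → K v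

  _⊆_ : PointSet → PointSet → Set
  S ⊆ K = ∀ P → NZ P → S P → K P

  Tangent : PointSet → V3 → Set
  Tangent K L = Σ V3 λ P → NZ P × P on L × K P ×
                  (∀ Q → NZ Q → Q on L → K Q → Q ∼ P)

  Secant : PointSet → V3 → Set
  Secant K L = Σ V3 λ P → Σ V3 λ Q → NZ P × NZ Q × P on L × Q on L ×
                 K P × K Q × ¬ (P ∼ Q)

  BlockingSet : PointSet → Set
  BlockingSet K =
    (∀ L → NZ L → Σ V3 λ P → NZ P × P on L × K P) ×
    (∀ L → NZ L → ¬ (∀ P → NZ P → P on L → K P))

  MinimalBlockingSet : PointSet → Set₁
  MinimalBlockingSet K =
    BlockingSet K ×
    (∀ (S : PointSet) → Respects∼ S → S ⊆ K → BlockingSet S → K ⊆ S)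

  UniqueTangentAt : PointSet → V3 → Set
  UniqueTangentAt K P = Σ V3 λ L → NZ L × P on L × Tangent K L ×
                          (∀ L' → NZ L' → P on L' → Tangent K L' → L' ∼ L)

  RInftyProperty : PointSet → V3 → Set
  RInftyProperty K P = Σ V3 λ L → NZ L × P on L × Tangent K L ×
                         (∀ L' → NZ L' → P on L' → Tangent K L' → L' ∼ L) ×
                         (∀ L' → NZ L' → P on L' → ¬ (L' ∼ L) → Secant K L')

  Semioval : PointSet → Set
  Semioval K = ∀ P → NZ P → K P → UniqueTangentAt K P

  BlockingSemioval : PointSet → Set
  BlockingSemioval K = BlockingSet K × Semioval K

  -- Data of a k-construction with n = 2 + m points D_1,…,D_n
  -- (D_1 = D zero, D_2 = D (suc zero)).
  record KData (m : ℕ) : Set where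
    field
      a b c : V3
      a-nz : NZ a
      b-nz : NZ b
      c-nz : NZ c
      nonConcurrent : ¬ (Σ V3 λ P → NZ P × P on a × P on b × P on c)
    C = a ⊗ b
    B = a ⊗ c
    A = b ⊗ c
    field
      ℓ : V3
      ℓ-nz : NZ ℓ
      A-on-ℓ : A on ℓ
      ℓ≁b : ¬ (ℓ ∼ b)
      ℓ≁c : ¬ (ℓ ∼ c)
    A' = ℓ ⊗ a
    field
      D : Fin (suc (suc m)) → V3
      D-nz : ∀ i → NZ (D i)
      D-on-ℓ : ∀ i → D i on ℓ
      D≁A : ∀ i → ¬ (D i ∼ A)
      D≁A' : ∀ i → ¬ (D i ∼ A')
      D-distinct : ∀ i j → D i ∼ D j → i ≡ j
      n≤q-2 : suc (suc m) Data.Nat.+ 2 Data.Nat.≤ q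
    Bp : Fin (suc (suc m)) → V3
    Bp i = (B ⊗ D i) ⊗ b
    Cp : Fin (suc (suc m)) → V3
    Cp i = (C ⊗ D i) ⊗ c
    C₂ = (A' ⊗ Bp Fin.zero) ⊗ c
    field
      -- q odd: D_2 = C C_2 ∩ ℓ  (q even: D_2 arbitrary, covered by the above)
      D₂-odd : ¬ (2 ∣ q) → D (Fin.suc Fin.zero) ∼ ((C ⊗ C₂) ⊗ ℓ)

    Triangle : PointSet
    Triangle X = (X on a × ¬ (X on b) × ¬ (X on c)) ⊎
                 (¬ (X on a) × X on b × ¬ (X on c)) ⊎
                 (¬ (X on a) × ¬ (X on b) × X on c)

    KSet : PointSet
    KSet X = (Triangle X ⊎ (∃[ i ] X ∼ D i)) ×
             (∀ i → ¬ (X ∼ Bp i)) × (∀ i → ¬ (X ∼ Cp i))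

{-# OPTIONS --safe #-}
module Submission where

-- A point of the vertexless triangle on a line through the vertex B (resp. C)
-- lies on b (resp. c).  Hence B Dᵢ meets 𝓑 only in Dᵢ: its point on b is the
-- removed Bᵢ and its point on ℓ is Dᵢ; likewise C Dᵢ.  So D₁ lies on two
-- tangents and 𝓑 is not a semioval.
-- For a point P of 𝓑 on b, the line PB is tangent (a Dⱼ on it would force
-- P = Bⱼ), every line through P other than PB and b meets a in a point of 𝓑,
-- and of the q + 1 points of b only C, A, B₁, …, Bₙ are missing from 𝓑, so
-- k ≥ 2q, i.e. n + 2 < q, leaves a second point of 𝓑 on b.

open import Level using (0ℓ)
open import Algebra.Bundles using (CommutativeRing)
open import Algebra.Solver.Ring.AlmostCommutativeRing
  using (_-Raw-AlmostCommutative⟶_; fromCommutativeRing)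
import Data.Maybe as Maybe
open import Data.Nat as ℕ using (ℕ; zero; suc)
import Data.Nat.Properties as ℕP
open import Data.Integer as ℤ using (ℤ; +_; -[1+_]; _⊖_)
import Data.Integer.Properties as ℤP
open import Data.Fin as Fin using (Fin)
import Data.Fin.Properties as FinP
open import Data.Vec.Functional using (_∷_)
open import Data.Product using (Σ; ∃-syntax; _×_; _,_; proj₁; proj₂)
open import Data.Sum using (inj₁; inj₂)
open import Data.Empty using (⊥-elim)
open import Function using (_∘_)
open import Relation.Nullary using (¬_; Dec; yes; no; ¬?; contradiction)
open import Relation.Nullary.Decidable using (dec⇒maybe)
open import Relation.Binary.PropositionalEquality as ≡ using (_≡_; cong)
open import Defs

-- The solver decides equality of coefficients, which is impossible in an
-- abstract field, so the coefficients are integers mapped into the ring.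
module IntegerCoefficients (R : CommutativeRing 0ℓ 0ℓ) where
  open CommutativeRing R
  open import Algebra.Properties.Ring ring
    using (-0#≈0#; -‿involutive; -‿+-comm; -‿distribˡ-*; -‿distribʳ-*)
  open import Algebra.Properties.Semiring.Mult semiring
    using (×-homo-+; ×1-homo-*) renaming (_×_ to _×ₙ_)
  open import Relation.Binary.Reasoning.Setoid setoid

  fromℤ : ℤ → Carrier
  fromℤ (+ n)      = n ×ₙ 1#
  fromℤ -[1+ n ]   = - (suc n ×ₙ 1#)

  fromℤ-neg : ∀ i → fromℤ (ℤ.- i) ≈ - fromℤ i
  fromℤ-neg (+ zero)  = sym -0#≈0#
  fromℤ-neg (+ suc n) = refl
  fromℤ-neg -[1+ n ]  = sym (-‿involutive _)

  [1+x]-[1+y]≈x-y : ∀ x y → (1# + x) - (1# + y) ≈ x - y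
  [1+x]-[1+y]≈x-y x y = begin
    (1# + x) + - (1# + y)     ≈⟨ +-congˡ (-‿+-comm 1# y) ⟨
    (1# + x) + (- 1# + - y)   ≈⟨ +-congʳ (+-comm 1# x) ⟩
    (x + 1#) + (- 1# + - y)   ≈⟨ +-assoc x 1# _ ⟩
    x + (1# + (- 1# + - y))   ≈⟨ +-congˡ (+-assoc 1# (- 1#) (- y)) ⟨
    x + ((1# + - 1#) + - y)   ≈⟨ +-congˡ (+-congʳ (-‿inverseʳ 1#)) ⟩
    x + (0# + - y)            ≈⟨ +-congˡ (+-identityˡ (- y)) ⟩
    x - y                     ∎

  fromℤ-⊖ : ∀ m n → fromℤ (m ⊖ n) ≈ m ×ₙ 1# - n ×ₙ 1#
  fromℤ-⊖ zero    zero    = sym (-‿inverseʳ 0#)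
  fromℤ-⊖ zero    (suc n) = sym (+-identityˡ _)
  fromℤ-⊖ (suc m) zero    = sym (trans (+-congˡ -0#≈0#) (+-identityʳ _))
  fromℤ-⊖ (suc m) (suc n) = begin
    fromℤ (suc m ⊖ suc n)      ≡⟨ ≡.cong fromℤ (ℤP.[1+m]⊖[1+n]≡m⊖n m n) ⟩
    fromℤ (m ⊖ n)              ≈⟨ fromℤ-⊖ m n ⟩
    m ×ₙ 1# - n ×ₙ 1#          ≈⟨ [1+x]-[1+y]≈x-y _ _ ⟨
    suc m ×ₙ 1# - suc n ×ₙ 1#  ∎

  fromℤ-+ : ∀ i j → fromℤ (i ℤ.+ j) ≈ fromℤ i + fromℤ j
  fromℤ-+ (+ m)    (+ n)    = ×-homo-+ 1# m n
  fromℤ-+ (+ m)    -[1+ n ] = fromℤ-⊖ m (suc n)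
  fromℤ-+ -[1+ m ] (+ n)    = trans (fromℤ-⊖ n (suc m)) (+-comm _ _)
  fromℤ-+ -[1+ m ] -[1+ n ] = begin
    - (suc (suc (m ℕ.+ n)) ×ₙ 1#)      ≡⟨ ≡.cong (λ k → - (suc k ×ₙ 1#)) (ℕP.+-suc m n) ⟨
    - ((suc m ℕ.+ suc n) ×ₙ 1#)        ≈⟨ -‿cong (×-homo-+ 1# (suc m) (suc n)) ⟩
    - (suc m ×ₙ 1# + suc n ×ₙ 1#)      ≈⟨ -‿+-comm _ _ ⟨
    - (suc m ×ₙ 1#) + - (suc n ×ₙ 1#)  ∎

  fromℤ-+m* : ∀ m j → fromℤ (+ m ℤ.* j) ≈ m ×ₙ 1# * fromℤ j
  fromℤ-+m* m (+ n) = begin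
    fromℤ (+ m ℤ.* + n)  ≡⟨ ≡.cong fromℤ (ℤP.pos-* m n) ⟨
    (m ℕ.* n) ×ₙ 1#      ≈⟨ ×1-homo-* m n ⟩
    m ×ₙ 1# * n ×ₙ 1#    ∎
  fromℤ-+m* m -[1+ n ] = begin
    fromℤ (+ m ℤ.* ℤ.- (+ suc n))  ≡⟨ ≡.cong fromℤ (ℤP.neg-distribʳ-* (+ m) (+ suc n)) ⟨
    fromℤ (ℤ.- (+ m ℤ.* + suc n))  ≈⟨ fromℤ-neg (+ m ℤ.* + suc n) ⟩
    - fromℤ (+ m ℤ.* + suc n)      ≈⟨ -‿cong (fromℤ-+m* m (+ suc n)) ⟩
    - (m ×ₙ 1# * suc n ×ₙ 1#)      ≈⟨ -‿distribʳ-* _ _ ⟩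
    m ×ₙ 1# * - (suc n ×ₙ 1#)      ∎

  fromℤ-* : ∀ i j → fromℤ (i ℤ.* j) ≈ fromℤ i * fromℤ j
  fromℤ-* (+ m)    j = fromℤ-+m* m j
  fromℤ-* -[1+ m ] j = begin
    fromℤ (ℤ.- (+ suc m) ℤ.* j)  ≡⟨ ≡.cong fromℤ (ℤP.neg-distribˡ-* (+ suc m) j) ⟨
    fromℤ (ℤ.- (+ suc m ℤ.* j))  ≈⟨ fromℤ-neg (+ suc m ℤ.* j) ⟩
    - fromℤ (+ suc m ℤ.* j)      ≈⟨ -‿cong (fromℤ-+m* (suc m) j) ⟩
    - (suc m ×ₙ 1# * fromℤ j)    ≈⟨ -‿distribˡ-* _ _ ⟩
    - (suc m ×ₙ 1#) * fromℤ j    ∎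

  fromℤ-homomorphism : ℤ.+-*-rawRing -Raw-AlmostCommutative⟶ fromCommutativeRing R
  fromℤ-homomorphism = record
    { ⟦_⟧    = fromℤ
    ; +-homo = fromℤ-+
    ; *-homo = fromℤ-*
    ; -‿homo = fromℤ-neg
    ; 0-homo = refl
    ; 1-homo = +-identityʳ 1#
    }

  open import Algebra.Solver.Ring ℤ.+-*-rawRing (fromCommutativeRing R) fromℤ-homomorphism
    (λ i j → Maybe.map (reflexive ∘ ≡.cong fromℤ) (dec⇒maybe (i ℤ.≟ j))) public

∃-unrelated : ∀ {r n} → r ℕ.< n → (R : Fin n → Fin r → Set) → (∀ i j → Dec (R i j)) →
              (∀ {i i' j} → R i j → R i' j → i ≡ i') → ∃[ i ] ∀ j → ¬ R i j
∃-unrelated {r} {n} r<n R R? functional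
  with FinP.any? (λ i → FinP.all? (λ j → ¬? (R? i j)))
... | yes unrelated = unrelated
... | no  ∄unrelated = contradiction (FinP.injective⇒≤ partner-injective) (ℕP.<⇒≱ r<n)
  where
  partner : ∀ i → ∃[ j ] R i j
  partner i with FinP.any? (R? i)
  ... | yes related = related
  ... | no  ¬related = ⊥-elim (∄unrelated (i , λ j Rij → ¬related (j , Rij)))
  partner-injective : ∀ {i i'} → proj₁ (partner i) ≡ proj₁ (partner i') → i ≡ i'
  partner-injective {i} {i'} same =
    functional (proj₂ (partner i)) (≡.subst (R i') (≡.sym same) (proj₂ (partner i')))

module Projective {q : ℕ} (F : FiniteField q) where
  open FiniteField F renaming (ring to R)
  open CommutativeRing R
  open import Algebra.Properties.Ring ring using (x∙y⁻¹≈ε⇒x≈y)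
  open IntegerCoefficients R using (solve; _:+_; _:*_; _:-_; :-_; _:=_; con)
  open import Relation.Binary.Reasoning.Setoid setoid
  open PG F
  open V3

  x≉0∧x*y≈0⇒y≈0 : ∀ {s t} → ¬ s ≈ 0# → s * t ≈ 0# → t ≈ 0#
  x≉0∧x*y≈0⇒y≈0 {s} {t} s≉0 st≈0 with inverse s s≉0
  ... | w , sw≈1 = begin
    t            ≈⟨ *-identityˡ t ⟨
    1# * t       ≈⟨ *-congʳ sw≈1 ⟨
    (s * w) * t  ≈⟨ solve 3 (λ s w t → (s :* w) :* t := w :* (s :* t)) refl s w t ⟩
    w * (s * t)  ≈⟨ *-congˡ st≈0 ⟩
    w * 0#       ≈⟨ zeroʳ w ⟩
    0#           ∎

  x≈0⇒y*x≈0 : ∀ s {t} → t ≈ 0# → s * t ≈ 0#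
  x≈0⇒y*x≈0 s t≈0 = trans (*-congˡ t≈0) (zeroʳ s)

  IsZero : V3 → Set
  IsZero u = x u ≈ 0# × y u ≈ 0# × z u ≈ 0#

  IsZero? : ∀ u → Dec (IsZero u)
  IsZero? u with x u ≟ 0# | y u ≟ 0# | z u ≟ 0#
  ... | yes x≈0 | yes y≈0 | yes z≈0 = yes (x≈0 , y≈0 , z≈0)
  ... | no  x≉0 | _       | _       = no (x≉0 ∘ proj₁)
  ... | yes _   | no  y≉0 | _       = no (y≉0 ∘ proj₁ ∘ proj₂)
  ... | yes _   | yes _   | no  z≉0 = no (z≉0 ∘ proj₂ ∘ proj₂)

  infix 4 _≃_·_
  _≃_·_ : V3 → Carrier → V3 → Set
  u ≃ t · v = (x u ≈ t * x v) × (y u ≈ t * y v) × (z u ≈ t * z v)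

  -- x (rot u ⊗ rot v) and x (rot (rot u) ⊗ rot (rot v)) are by definition the
  -- y- and z-coordinates of u ⊗ v, so coordinatewise facts are proved for x only.
  rot : V3 → V3
  rot u = ⟨ y u , z u , x u ⟩

  rot-≃ : ∀ {u t v} → u ≃ t · v → rot u ≃ t · rot v
  rot-≃ (ex , ey , ez) = ey , ez , ex

  rot-NZ : ∀ {u} → NZ u → NZ (rot u)
  rot-NZ u≠0 (ey , ez , ex) = u≠0 (ex , ey , ez)

  rot-IsZero : ∀ {u} → IsZero u → IsZero (rot u)
  rot-IsZero (ex , ey , ez) = ey , ez , ex

  rot-∼⁻¹ : ∀ {u v} → rot u ∼ rot v → u ∼ v
  rot-∼⁻¹ (t , t≉0 , (ey , ez , ex)) = t , t≉0 , (ex , ey , ez)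

  dot-rot : ∀ u v → dot (rot u) (rot v) ≈ dot u v
  dot-rot u v = solve 6 (λ a b c d e f → b :* e :+ c :* f :+ a :* d := a :* d :+ b :* e :+ c :* f) refl
    (x u) (y u) (z u) (x v) (y v) (z v)

  dot-comm : ∀ u v → dot u v ≈ dot v u
  dot-comm u v = +-cong (+-cong (*-comm _ _) (*-comm _ _)) (*-comm _ _)

  on-sym : ∀ {P L} → P on L → L on P
  on-sym {P} {L} P-on-L = trans (dot-comm L P) P-on-L

  dot-scaleˡ : ∀ {u t v} w → u ≃ t · v → dot u w ≈ t * dot v w
  dot-scaleˡ {u} {t} {v} w (ex , ey , ez) = begin
    x u * x w + y u * y w + z u * z w
      ≈⟨ +-cong (+-cong (*-congʳ ex) (*-congʳ ey)) (*-congʳ ez) ⟩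
    t * x v * x w + t * y v * y w + t * z v * z w
      ≈⟨ solve 7 (λ t a b c d e f → t :* a :* d :+ t :* b :* e :+ t :* c :* f
                                   := t :* (a :* d :+ b :* e :+ c :* f)) refl
           t (x v) (y v) (z v) (x w) (y w) (z w) ⟩
    t * dot v w ∎

  on-respˡ : ∀ {u v L} → u ∼ v → v on L → u on L
  on-respˡ {L = L} (t , _ , u≃tv) v-on-L = trans (dot-scaleˡ L u≃tv) (x≈0⇒y*x≈0 t v-on-L)

  on-respʳ : ∀ {P L M} → L ∼ M → P on M → P on L
  on-respʳ L∼M = on-sym ∘ on-respˡ L∼M ∘ on-sym

  ⊗-on₁ : ∀ u v → (u ⊗ v) on u
  ⊗-on₁ u v = solve 6 (λ a b c d e f → (b :* f :- c :* e) :* a :+ (c :* d :- a :* f) :* b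
                                         :+ (a :* e :- b :* d) :* c := con (+ 0)) refl
    (x u) (y u) (z u) (x v) (y v) (z v)

  ⊗-on₂ : ∀ u v → (u ⊗ v) on v
  ⊗-on₂ u v = solve 6 (λ a b c d e f → (b :* f :- c :* e) :* d :+ (c :* d :- a :* f) :* e
                                         :+ (a :* e :- b :* d) :* f := con (+ 0)) refl
    (x u) (y u) (z u) (x v) (y v) (z v)

  on₁-⊗ : ∀ u v → u on (u ⊗ v)
  on₁-⊗ u v = on-sym (⊗-on₁ u v)

  on₂-⊗ : ∀ u v → v on (u ⊗ v)
  on₂-⊗ u v = on-sym (⊗-on₂ u v)

  ⊗-of-multiples-x : ∀ {u s v t w} → u ≃ s · w → v ≃ t · w → x (u ⊗ v) ≈ 0#
  ⊗-of-multiples-x {u} {s} {v} {t} {w} (_ , uy , uz) (_ , vy , vz) = begin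
    x (u ⊗ v)                               ≈⟨ +-cong (*-cong uy vz) (-‿cong (*-cong uz vy)) ⟩
    s * y w * (t * z w) - s * z w * (t * y w)
      ≈⟨ solve 4 (λ s t a b → s :* a :* (t :* b) :- s :* b :* (t :* a) := con (+ 0)) refl
           s t (y w) (z w) ⟩
    0# ∎

  ⊗-of-multiples : ∀ {u s v t w} → u ≃ s · w → v ≃ t · w → IsZero (u ⊗ v)
  ⊗-of-multiples u≃sw v≃tw =
      ⊗-of-multiples-x u≃sw v≃tw
    , ⊗-of-multiples-x (rot-≃ u≃sw) (rot-≃ v≃tw)
    , ⊗-of-multiples-x (rot-≃ (rot-≃ u≃sw)) (rot-≃ (rot-≃ v≃tw))

  ≃-refl : ∀ {u} → u ≃ 1# · u
  ≃-refl = sym (*-identityˡ _) , sym (*-identityˡ _) , sym (*-identityˡ _)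

  ∼-refl : ∀ {u} → u ∼ u
  ∼-refl = 1# , (λ 1≈0 → 0≉1 (sym 1≈0)) , ≃-refl

  ∼⇒⊗-zero : ∀ {u v} → u ∼ v → IsZero (u ⊗ v)
  ∼⇒⊗-zero (_ , _ , u≃tv) = ⊗-of-multiples u≃tv ≃-refl

  -- If x v ≉ 0 then u = (x u / x v) v, the other two coordinates following
  -- from the vanishing of the y- and z-coordinates of u ⊗ v.
  ⊗-zero⇒∼-x : ∀ {u v} → NZ u → ¬ x v ≈ 0# → IsZero (u ⊗ v) → u ∼ v
  ⊗-zero⇒∼-x {u} {v} u≠0 xv≉0 (_ , ⊗y≈0 , ⊗z≈0) with inverse (x v) xv≉0
  ... | w , xv*w≈1 = t , t≉0 , u≃tv
    where
    t : Carrier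
    t = x u * w
    pivot : ∀ {a b} → x u * b ≈ a * x v → a ≈ t * b
    pivot {a} {b} cross = begin
      a                  ≈⟨ *-identityʳ a ⟨
      a * 1#             ≈⟨ *-congˡ xv*w≈1 ⟨
      a * (x v * w)      ≈⟨ *-assoc a (x v) w ⟨
      (a * x v) * w      ≈⟨ *-congʳ cross ⟨
      (x u * b) * w      ≈⟨ solve 3 (λ a d w → (a :* d) :* w := (a :* w) :* d) refl (x u) b w ⟩
      t * b              ∎
    u≃tv : u ≃ t · v
    u≃tv = pivot refl
         , pivot (x∙y⁻¹≈ε⇒x≈y _ _ ⊗z≈0)
         , pivot (sym (x∙y⁻¹≈ε⇒x≈y _ _ ⊗y≈0))
    t≉0 : ¬ t ≈ 0#
    t≉0 t≈0 =
      u≠0 (vanish (proj₁ u≃tv) , vanish (proj₁ (proj₂ u≃tv)) , vanish (proj₂ (proj₂ u≃tv)))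
      where
      vanish : ∀ {a b} → a ≈ t * b → a ≈ 0#
      vanish {b = b} a≈tb = trans a≈tb (trans (*-congʳ t≈0) (zeroˡ b))

  ⊗-zero⇒∼ : ∀ {u v} → NZ u → NZ v → IsZero (u ⊗ v) → u ∼ v
  ⊗-zero⇒∼ {u} {v} u≠0 v≠0 u⊗v≈0 with x v ≟ 0# | y v ≟ 0# | z v ≟ 0#
  ... | no xv≉0 | _       | _       = ⊗-zero⇒∼-x u≠0 xv≉0 u⊗v≈0
  ... | yes _   | no yv≉0 | _       =
    rot-∼⁻¹ (⊗-zero⇒∼-x (rot-NZ u≠0) yv≉0 (rot-IsZero u⊗v≈0))
  ... | yes _   | yes _   | no zv≉0 =
    rot-∼⁻¹ (rot-∼⁻¹ (⊗-zero⇒∼-x (rot-NZ (rot-NZ u≠0)) zv≉0 (rot-IsZero (rot-IsZero u⊗v≈0))))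
  ... | yes xv≈0 | yes yv≈0 | yes zv≈0 = ⊥-elim (v≠0 (xv≈0 , yv≈0 , zv≈0))

  ∼-sym : ∀ {u v} → u ∼ v → v ∼ u
  ∼-sym {u} {v} (t , t≉0 , (ex , ey , ez)) with inverse t t≉0
  ... | s , ts≈1 = s , s≉0 , (flip ex , flip ey , flip ez)
    where
    s≉0 : ¬ s ≈ 0#
    s≉0 s≈0 = 0≉1 (trans (sym (x≈0⇒y*x≈0 t s≈0)) ts≈1)
    flip : ∀ {a b} → a ≈ t * b → b ≈ s * a
    flip {a} {b} a≈tb = begin
      b            ≈⟨ *-identityˡ b ⟨
      1# * b       ≈⟨ *-congʳ ts≈1 ⟨
      (t * s) * b  ≈⟨ solve 3 (λ t s b → (t :* s) :* b := s :* (t :* b)) refl t s b ⟩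
      s * (t * b)  ≈⟨ *-congˡ a≈tb ⟨
      s * a        ∎

  ∼-trans : ∀ {u v w} → NZ u → NZ w → u ∼ v → v ∼ w → u ∼ w
  ∼-trans u≠0 w≠0 (_ , _ , u≃sv) v∼w with ∼-sym v∼w
  ... | _ , _ , w≃tv = ⊗-zero⇒∼ u≠0 w≠0 (⊗-of-multiples u≃sv w≃tv)

  ∼-dec : ∀ {u v} → NZ u → NZ v → Dec (u ∼ v)
  ∼-dec {u} {v} u≠0 v≠0 with IsZero? (u ⊗ v)
  ... | yes u⊗v≈0 = yes (⊗-zero⇒∼ u≠0 v≠0 u⊗v≈0)
  ... | no  u⊗v≉0 = no (u⊗v≉0 ∘ ∼⇒⊗-zero)

  NZ-⊗ : ∀ {u v} → NZ u → NZ v → ¬ u ∼ v → NZ (u ⊗ v)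
  NZ-⊗ u≠0 v≠0 u≁v = u≁v ∘ ⊗-zero⇒∼ u≠0 v≠0

  rot-on : ∀ {P L} → P on L → rot P on rot L
  rot-on {P} {L} P-on-L = trans (dot-rot P L) P-on-L

  -- The vector identity P × (L × M) = (P·M) L − (P·L) M, coordinatewise
  on-both⇒⊗-x : ∀ {P L M} → P on L → P on M → x (P ⊗ (L ⊗ M)) ≈ 0#
  on-both⇒⊗-x {P} {L} {M} P-on-L P-on-M = begin
    x (P ⊗ (L ⊗ M))
      ≈⟨ solve 9 (λ a b c d e f g h i → b :* (d :* h :- e :* g) :- c :* (f :* g :- d :* i)
                   := d :* (a :* g :+ b :* h :+ c :* i) :- g :* (a :* d :+ b :* e :+ c :* f)) refl
           (x P) (y P) (z P) (x L) (y L) (z L) (x M) (y M) (z M) ⟩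
    x L * dot P M - x M * dot P L
      ≈⟨ +-cong (x≈0⇒y*x≈0 (x L) P-on-M) (-‿cong (x≈0⇒y*x≈0 (x M) P-on-L)) ⟩
    0# - 0#                        ≈⟨ -‿inverseʳ 0# ⟩
    0#                             ∎

  on-both⇒∼-⊗ : ∀ {P L M} → NZ P → NZ L → NZ M → ¬ L ∼ M → P on L → P on M → P ∼ (L ⊗ M)
  on-both⇒∼-⊗ P≠0 L≠0 M≠0 L≁M P-on-L P-on-M = ⊗-zero⇒∼ P≠0 (NZ-⊗ L≠0 M≠0 L≁M)
    ( on-both⇒⊗-x P-on-L P-on-M
    , on-both⇒⊗-x (rot-on P-on-L) (rot-on P-on-M)
    , on-both⇒⊗-x (rot-on (rot-on P-on-L)) (rot-on (rot-on P-on-M)))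

  unique-meet : ∀ {P Q L M} → NZ P → NZ Q → NZ L → NZ M → ¬ L ∼ M →
                P on L → P on M → Q on L → Q on M → P ∼ Q
  unique-meet P≠0 Q≠0 L≠0 M≠0 L≁M P-on-L P-on-M Q-on-L Q-on-M =
    ∼-trans P≠0 Q≠0 (on-both⇒∼-⊗ P≠0 L≠0 M≠0 L≁M P-on-L P-on-M)
                    (∼-sym (on-both⇒∼-⊗ Q≠0 L≠0 M≠0 L≁M Q-on-L Q-on-M))

  unique-join : ∀ {P Q L M} → NZ P → NZ Q → NZ L → NZ M → ¬ P ∼ Q →
                P on L → P on M → Q on L → Q on M → L ∼ M
  unique-join P≠0 Q≠0 L≠0 M≠0 P≁Q P-on-L P-on-M Q-on-L Q-on-M =
    unique-meet L≠0 M≠0 P≠0 Q≠0 P≁Q (on-sym P-on-L) (on-sym Q-on-L) (on-sym P-on-M) (on-sym Q-on-M)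

  separated-by-line : ∀ {X Y L} → Y on L → ¬ X on L → ¬ X ∼ Y
  separated-by-line Y-on-L X-off-L X∼Y = X-off-L (on-respˡ X∼Y Y-on-L)

  separated-by-point : ∀ {P L M} → P on L → ¬ P on M → ¬ L ∼ M
  separated-by-point P-on-L P-off-M L∼M = P-off-M (on-respʳ (∼-sym L∼M) P-on-L)

  point-on : ∀ {L} → NZ L → Σ V3 λ P → NZ P × P on L
  point-on {L} L≠0 with z L ≟ 0# | x L ≟ 0#
  ... | no zL≉0 | _ = ⟨ 0# , z L , - y L ⟩ , zL≉0 ∘ proj₁ ∘ proj₂ ,
    solve 3 (λ a b c → con (+ 0) :* a :+ c :* b :+ (:- b) :* c := con (+ 0)) refl (x L) (y L) (z L)
  ... | yes _ | no xL≉0 = ⟨ - z L , 0# , x L ⟩ , xL≉0 ∘ proj₂ ∘ proj₂ ,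
    solve 3 (λ a b c → (:- c) :* a :+ con (+ 0) :* b :+ a :* c := con (+ 0)) refl (x L) (y L) (z L)
  ... | yes zL≈0 | yes xL≈0 = ⟨ y L , - x L , 0# ⟩ , (λ P≈0 → L≠0 (xL≈0 , proj₁ P≈0 , zL≈0)) ,
    solve 3 (λ a b c → b :* a :+ (:- a) :* b :+ con (+ 0) :* c := con (+ 0)) refl (x L) (y L) (z L)

  meet : ∀ {L M} → NZ L → NZ M → Σ V3 λ P → NZ P × P on L × P on M
  meet {L} {M} L≠0 M≠0 with ∼-dec L≠0 M≠0
  ... | no L≁M = L ⊗ M , NZ-⊗ L≠0 M≠0 L≁M , ⊗-on₁ L M , ⊗-on₂ L M
  ... | yes L∼M with point-on L≠0
  ...   | P , P≠0 , P-on-L = P , P≠0 , P-on-L , on-respʳ (∼-sym L∼M) P-on-L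

  Tangent⇒¬Secant : ∀ {K L} → Tangent K L → ¬ Secant K L
  Tangent⇒¬Secant (_ , _ , _ , _ , only) (U , V , U≠0 , V≠0 , U-on-L , V-on-L , KU , KV , U≁V) =
    U≁V (∼-trans U≠0 V≠0 (only U U≠0 U-on-L KU) (∼-sym (only V V≠0 V-on-L KV)))

  tangent-and-secants⇒RInfty : ∀ {K P L} → NZ L → P on L → Tangent K L →
    (∀ L' → NZ L' → P on L' → ¬ L' ∼ L → Secant K L') → RInftyProperty K P
  tangent-and-secants⇒RInfty {K} {P} {L} L≠0 P-on-L tangent secant =
    L , L≠0 , P-on-L , tangent , unique , secant
    where
    unique : ∀ L' → NZ L' → P on L' → Tangent K L' → L' ∼ L
    unique L' L'≠0 P-on-L' tangent' with ∼-dec L'≠0 L≠0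
    ... | yes L'∼L = L'∼L
    ... | no  L'≁L = contradiction (secant L' L'≠0 P-on-L' L'≁L) (Tangent⇒¬Secant tangent')

  two-tangents⇒¬Semioval : ∀ {K P L M} → NZ P → K P → NZ L → NZ M → ¬ L ∼ M →
    P on L → P on M → Tangent K L → Tangent K M → ¬ Semioval K
  two-tangents⇒¬Semioval P≠0 KP L≠0 M≠0 L≁M P-on-L P-on-M tangent-L tangent-M semioval
    with semioval _ P≠0 KP
  ... | _ , _ , _ , _ , unique =
    L≁M (∼-trans L≠0 M≠0 (unique _ L≠0 P-on-L tangent-L) (∼-sym (unique _ M≠0 P-on-M tangent-M)))

  along : V3 → V3 → Carrier → V3
  along P C e = ⟨ x P + e * x C , y P + e * y C , z P + e * z C ⟩

  along-on : ∀ {P C L} e → P on L → C on L → along P C e on L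
  along-on {P} {C} {L} e P-on-L C-on-L = begin
    dot (along P C e) L
      ≈⟨ solve 10 (λ p₁ p₂ p₃ c₁ c₂ c₃ e l₁ l₂ l₃ →
                     (p₁ :+ e :* c₁) :* l₁ :+ (p₂ :+ e :* c₂) :* l₂ :+ (p₃ :+ e :* c₃) :* l₃
                  := (p₁ :* l₁ :+ p₂ :* l₂ :+ p₃ :* l₃)
                     :+ e :* (c₁ :* l₁ :+ c₂ :* l₂ :+ c₃ :* l₃)) refl
           (x P) (y P) (z P) (x C) (y C) (z C) e (x L) (y L) (z L) ⟩
    dot P L + e * dot C L  ≈⟨ +-cong P-on-L (x≈0⇒y*x≈0 e C-on-L) ⟩
    0# + 0#                ≈⟨ +-identityˡ 0# ⟩
    0#                     ∎

  along-⊗-x : ∀ P C e → x (along P C e ⊗ C) ≈ x (P ⊗ C)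
  along-⊗-x P C e =
    solve 5 (λ p₂ p₃ c₂ c₃ e → (p₂ :+ e :* c₂) :* c₃ :- (p₃ :+ e :* c₃) :* c₂
                            := p₂ :* c₃ :- p₃ :* c₂) refl
      (y P) (z P) (y C) (z C) e

  along-⊗-along-x : ∀ P C e f → x (along P C e ⊗ along P C f) ≈ (f - e) * x (P ⊗ C)
  along-⊗-along-x P C e f =
    solve 6 (λ p₂ p₃ c₂ c₃ e f → (p₂ :+ e :* c₂) :* (p₃ :+ f :* c₃)
                               :- (p₃ :+ e :* c₃) :* (p₂ :+ f :* c₂)
                               := (f :- e) :* (p₂ :* c₃ :- p₃ :* c₂)) refl
      (y P) (z P) (y C) (z C) e f

  along-⊗ : ∀ {P C} e → IsZero (along P C e ⊗ C) → IsZero (P ⊗ C)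
  along-⊗ {P} {C} e (ex , ey , ez) =
      trans (sym (along-⊗-x P C e)) ex
    , trans (sym (along-⊗-x (rot P) (rot C) e)) ey
    , trans (sym (along-⊗-x (rot (rot P)) (rot (rot C)) e)) ez

  along-⊗-along : ∀ {P C} e f → ¬ f - e ≈ 0# → IsZero (along P C e ⊗ along P C f) → IsZero (P ⊗ C)
  along-⊗-along {P} {C} e f f-e≉0 (ex , ey , ez) =
      x≉0∧x*y≈0⇒y≈0 f-e≉0 (trans (sym (along-⊗-along-x P C e f)) ex)
    , x≉0∧x*y≈0⇒y≈0 f-e≉0 (trans (sym (along-⊗-along-x (rot P) (rot C) e f)) ey)
    , x≉0∧x*y≈0⇒y≈0 f-e≉0 (trans (sym (along-⊗-along-x (rot (rot P)) (rot (rot C)) e f)) ez)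

  module _ {P C : V3} (P≠0 : NZ P) (C≠0 : NZ C) (P≁C : ¬ P ∼ C) where

    P⊗C≠0 : NZ (P ⊗ C)
    P⊗C≠0 = NZ-⊗ P≠0 C≠0 P≁C

    along-NZ : ∀ e → NZ (along P C e)
    along-NZ e (ex , ey , ez) =
      P⊗C≠0 (along-⊗ e (⊗-of-multiples {s = 0#} (vanish ex , vanish ey , vanish ez) ≃-refl))
      where
      vanish : ∀ {a b} → a ≈ 0# → a ≈ 0# * b
      vanish a≈0 = trans a≈0 (sym (zeroˡ _))

    along-≁ : ∀ e → ¬ along P C e ∼ C
    along-≁ e = P⊗C≠0 ∘ along-⊗ e ∘ ∼⇒⊗-zero

    along-injective : ∀ e f → along P C e ∼ along P C f → e ≈ f
    along-injective e f same with (f - e) ≟ 0#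
    ... | yes f-e≈0 = sym (x∙y⁻¹≈ε⇒x≈y f e f-e≈0)
    ... | no  f-e≉0 = ⊥-elim (P⊗C≠0 (along-⊗-along e f f-e≉0 (∼⇒⊗-zero same)))

    -- The q points P + e C (e ∈ F) of PC are distinct and differ from C, and each
    -- Z j excludes at most one of them.
    ∃-point-avoiding : ∀ {r} → r ℕ.< q → (Z : Fin r → V3) → (∀ j → NZ (Z j)) →
      Σ V3 λ Y → NZ Y × (∀ {L} → P on L → C on L → Y on L) × ¬ Y ∼ C × (∀ j → ¬ Y ∼ Z j)
    ∃-point-avoiding r<q Z Z≠0 = Y i , Y≠0 i , along-on (enum i) , along-≁ (enum i) , avoids
      where
      Y : Fin q → V3
      Y i = along P C (enum i)
      Y≠0 : ∀ i → NZ (Y i)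
      Y≠0 i = along-NZ (enum i)
      functional : ∀ {i i' j} → Y i ∼ Z j → Y i' ∼ Z j → i ≡ i'
      functional {i} {i'} Yi∼Zj Yi'∼Zj =
        enum-inj i i' (along-injective _ _ (∼-trans (Y≠0 i) (Y≠0 i') Yi∼Zj (∼-sym Yi'∼Zj)))
      unrelated : ∃[ i ] ∀ j → ¬ Y i ∼ Z j
      unrelated = ∃-unrelated r<q (λ i j → Y i ∼ Z j) (λ i j → ∼-dec (Y≠0 i) (Z≠0 j)) functional
      i : Fin q
      i = proj₁ unrelated
      avoids : ∀ j → ¬ Y i ∼ Z j
      avoids = proj₂ unrelated

module KConstruction {q : ℕ} (F : FiniteField q) {m : ℕ} (K : PG.KData F m) where
  open PG F
  open PG.KData K
  open Projective F

  a≁b : ¬ a ∼ b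
  a≁b a∼b with meet a-nz c-nz
  ... | X , X≠0 , X-on-a , X-on-c =
    nonConcurrent (X , X≠0 , X-on-a , on-respʳ (∼-sym a∼b) X-on-a , X-on-c)

  a≁c : ¬ a ∼ c
  a≁c a∼c with meet a-nz b-nz
  ... | X , X≠0 , X-on-a , X-on-b =
    nonConcurrent (X , X≠0 , X-on-a , X-on-b , on-respʳ (∼-sym a∼c) X-on-a)

  b≁c : ¬ b ∼ c
  b≁c b∼c with meet a-nz b-nz
  ... | X , X≠0 , X-on-a , X-on-b =
    nonConcurrent (X , X≠0 , X-on-a , X-on-b , on-respʳ (∼-sym b∼c) X-on-b)

  A≠0 : NZ A
  A≠0 = NZ-⊗ b-nz c-nz b≁c

  B≠0 : NZ B
  B≠0 = NZ-⊗ a-nz c-nz a≁c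

  C≠0 : NZ C
  C≠0 = NZ-⊗ a-nz b-nz a≁b

  A-on-b : A on b
  A-on-b = ⊗-on₁ b c

  A-on-c : A on c
  A-on-c = ⊗-on₂ b c

  B-on-a : B on a
  B-on-a = ⊗-on₁ a c

  B-on-c : B on c
  B-on-c = ⊗-on₂ a c

  C-on-a : C on a
  C-on-a = ⊗-on₁ a b

  C-on-b : C on b
  C-on-b = ⊗-on₂ a b

  A-off-a : ¬ A on a
  A-off-a A-on-a = nonConcurrent (A , A≠0 , A-on-a , A-on-b , A-on-c)

  B-off-b : ¬ B on b
  B-off-b B-on-b = nonConcurrent (B , B≠0 , B-on-a , B-on-b , B-on-c)

  C-off-c : ¬ C on c
  C-off-c C-on-c = nonConcurrent (C , C≠0 , C-on-a , C-on-b , C-on-c)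

  on-a-b⇒∼C : ∀ {X} → NZ X → X on a → X on b → X ∼ C
  on-a-b⇒∼C X≠0 X-on-a X-on-b = unique-meet X≠0 C≠0 a-nz b-nz a≁b X-on-a X-on-b C-on-a C-on-b

  on-b-c⇒∼A : ∀ {X} → NZ X → X on b → X on c → X ∼ A
  on-b-c⇒∼A X≠0 X-on-b X-on-c = unique-meet X≠0 A≠0 b-nz c-nz b≁c X-on-b X-on-c A-on-b A-on-c

  B≁C : ¬ B ∼ C
  B≁C = separated-by-line C-on-b B-off-b

  ℓ≁a : ¬ ℓ ∼ a
  ℓ≁a = separated-by-point A-on-ℓ A-off-a

  A'≠0 : NZ A'
  A'≠0 = NZ-⊗ ℓ-nz a-nz ℓ≁a

  D-off-a : ∀ i → ¬ D i on a
  D-off-a i D-on-a =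
    D≁A' i (unique-meet (D-nz i) A'≠0 ℓ-nz a-nz ℓ≁a (D-on-ℓ i) D-on-a (⊗-on₁ ℓ a) (⊗-on₂ ℓ a))

  D-off-b : ∀ i → ¬ D i on b
  D-off-b i D-on-b = D≁A i (unique-meet (D-nz i) A≠0 ℓ-nz b-nz ℓ≁b (D-on-ℓ i) D-on-b A-on-ℓ A-on-b)

  D-off-c : ∀ i → ¬ D i on c
  D-off-c i D-on-c = D≁A i (unique-meet (D-nz i) A≠0 ℓ-nz c-nz ℓ≁c (D-on-ℓ i) D-on-c A-on-ℓ A-on-c)

  B-off-ℓ : ¬ B on ℓ
  B-off-ℓ B-on-ℓ =
    B-off-b (on-respˡ (unique-meet B≠0 A≠0 ℓ-nz c-nz ℓ≁c B-on-ℓ B-on-c A-on-ℓ A-on-c) A-on-b)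

  C-off-ℓ : ¬ C on ℓ
  C-off-ℓ C-on-ℓ =
    C-off-c (on-respˡ (unique-meet C≠0 A≠0 ℓ-nz b-nz ℓ≁b C-on-ℓ C-on-b A-on-ℓ A-on-b) A-on-c)

  BD CD : Fin (suc (suc m)) → V3
  BD i = B ⊗ D i
  CD i = C ⊗ D i

  B≁D : ∀ i → ¬ B ∼ D i
  B≁D i = separated-by-line (D-on-ℓ i) B-off-ℓ

  BD≠0 : ∀ i → NZ (BD i)
  BD≠0 i = NZ-⊗ B≠0 (D-nz i) (B≁D i)

  CD≠0 : ∀ i → NZ (CD i)
  CD≠0 i = NZ-⊗ C≠0 (D-nz i) (separated-by-line (D-on-ℓ i) C-off-ℓ)

  BD≁b : ∀ i → ¬ BD i ∼ b
  BD≁b i = separated-by-point (on₁-⊗ B (D i)) B-off-b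

  CD≁c : ∀ i → ¬ CD i ∼ c
  CD≁c i = separated-by-point (on₁-⊗ C (D i)) C-off-c

  Bp≠0 : ∀ i → NZ (Bp i)
  Bp≠0 i = NZ-⊗ (BD≠0 i) b-nz (BD≁b i)

  Cp≠0 : ∀ i → NZ (Cp i)
  Cp≠0 i = NZ-⊗ (CD≠0 i) c-nz (CD≁c i)

  Bp-on-b : ∀ i → Bp i on b
  Bp-on-b i = ⊗-on₂ (BD i) b

  Cp-on-c : ∀ i → Cp i on c
  Cp-on-c i = ⊗-on₂ (CD i) c

  KSet-on-a : ∀ {X} → X on a → ¬ X on b → ¬ X on c → KSet X
  KSet-on-a X-on-a X-off-b X-off-c =
      inj₁ (inj₁ (X-on-a , X-off-b , X-off-c))
    , (λ i → separated-by-line (Bp-on-b i) X-off-b)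
    , (λ i → separated-by-line (Cp-on-c i) X-off-c)

  KSet-on-b : ∀ {X} → ¬ X on a → X on b → ¬ X on c → (∀ i → ¬ X ∼ Bp i) → KSet X
  KSet-on-b X-off-a X-on-b X-off-c X≁Bp =
      inj₁ (inj₂ (inj₁ (X-off-a , X-on-b , X-off-c)))
    , X≁Bp
    , (λ i → separated-by-line (Cp-on-c i) X-off-c)

  KSet-D : ∀ i → KSet (D i)
  KSet-D i =
      inj₂ (i , ∼-refl)
    , (λ j → separated-by-line (Bp-on-b j) (D-off-b i))
    , (λ j → separated-by-line (Cp-on-c j) (D-off-c i))

  KSet-on-b⇒off-a-c : ∀ {X} → KSet X → X on b → ¬ X on a × ¬ X on c
  KSet-on-b⇒off-a-c (inj₁ (inj₁ (_ , X-off-b , _)) , _) X-on-b = ⊥-elim (X-off-b X-on-b)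
  KSet-on-b⇒off-a-c (inj₁ (inj₂ (inj₁ (X-off-a , _ , X-off-c))) , _) _ = X-off-a , X-off-c
  KSet-on-b⇒off-a-c (inj₁ (inj₂ (inj₂ (_ , X-off-b , _))) , _) X-on-b = ⊥-elim (X-off-b X-on-b)
  KSet-on-b⇒off-a-c (inj₂ (i , X∼Dᵢ) , _) X-on-b = ⊥-elim (D-off-b i (on-respˡ (∼-sym X∼Dᵢ) X-on-b))

  Triangle-through-B⇒on-b : ∀ {M X} → NZ M → B on M → ¬ M ∼ a → ¬ M ∼ c →
                            NZ X → X on M → Triangle X → X on b
  Triangle-through-B⇒on-b M≠0 B-on-M M≁a _ X≠0 X-on-M (inj₁ (X-on-a , _ , X-off-c)) =
    ⊥-elim (X-off-c (on-respˡ (unique-meet X≠0 B≠0 M≠0 a-nz M≁a X-on-M X-on-a B-on-M B-on-a) B-on-c))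
  Triangle-through-B⇒on-b _ _ _ _ _ _ (inj₂ (inj₁ (_ , X-on-b , _))) = X-on-b
  Triangle-through-B⇒on-b M≠0 B-on-M _ M≁c X≠0 X-on-M (inj₂ (inj₂ (X-off-a , _ , X-on-c))) =
    ⊥-elim (X-off-a (on-respˡ (unique-meet X≠0 B≠0 M≠0 c-nz M≁c X-on-M X-on-c B-on-M B-on-c) B-on-a))

  Triangle-through-C⇒on-c : ∀ {M X} → NZ M → C on M → ¬ M ∼ a → ¬ M ∼ b →
                            NZ X → X on M → Triangle X → X on c
  Triangle-through-C⇒on-c M≠0 C-on-M M≁a _ X≠0 X-on-M (inj₁ (X-on-a , X-off-b , _)) =
    ⊥-elim (X-off-b (on-respˡ (unique-meet X≠0 C≠0 M≠0 a-nz M≁a X-on-M X-on-a C-on-M C-on-a) C-on-b))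
  Triangle-through-C⇒on-c M≠0 C-on-M _ M≁b X≠0 X-on-M (inj₂ (inj₁ (X-off-a , X-on-b , _))) =
    ⊥-elim (X-off-a (on-respˡ (unique-meet X≠0 C≠0 M≠0 b-nz M≁b X-on-M X-on-b C-on-M C-on-b) C-on-a))
  Triangle-through-C⇒on-c _ _ _ _ _ _ (inj₂ (inj₂ (_ , _ , X-on-c))) = X-on-c

  on-BD∩ℓ⇒∼D : ∀ i {Q} → NZ Q → Q on BD i → Q on ℓ → Q ∼ D i
  on-BD∩ℓ⇒∼D i Q≠0 Q-on-BD Q-on-ℓ =
    unique-meet Q≠0 (D-nz i) (BD≠0 i) ℓ-nz (separated-by-point (on₁-⊗ B (D i)) B-off-ℓ)
      Q-on-BD Q-on-ℓ (on₂-⊗ B (D i)) (D-on-ℓ i)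

  on-CD∩ℓ⇒∼D : ∀ i {Q} → NZ Q → Q on CD i → Q on ℓ → Q ∼ D i
  on-CD∩ℓ⇒∼D i Q≠0 Q-on-CD Q-on-ℓ =
    unique-meet Q≠0 (D-nz i) (CD≠0 i) ℓ-nz (separated-by-point (on₁-⊗ C (D i)) C-off-ℓ)
      Q-on-CD Q-on-ℓ (on₂-⊗ C (D i)) (D-on-ℓ i)

  BD-tangent : ∀ i → Tangent KSet (BD i)
  BD-tangent i = D i , D-nz i , on₂-⊗ B (D i) , KSet-D i , only-Dᵢ
    where
    only-Dᵢ : ∀ Q → NZ Q → Q on BD i → KSet Q → Q ∼ D i
    only-Dᵢ Q Q≠0 Q-on-BD (inj₁ Q∈T , Q≁Bp , _) = ⊥-elim (Q≁Bp i
      (unique-meet Q≠0 (Bp≠0 i) (BD≠0 i) b-nz (BD≁b i) Q-on-BD Q-on-b (⊗-on₁ (BD i) b) (Bp-on-b i)))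
      where
      Q-on-b : Q on b
      Q-on-b = Triangle-through-B⇒on-b (BD≠0 i) (on₁-⊗ B (D i))
        (separated-by-point (on₂-⊗ B (D i)) (D-off-a i)) (separated-by-point (on₂-⊗ B (D i)) (D-off-c i))
        Q≠0 Q-on-BD Q∈T
    only-Dᵢ Q Q≠0 Q-on-BD (inj₂ (j , Q∼Dⱼ) , _) =
      on-BD∩ℓ⇒∼D i Q≠0 Q-on-BD (on-respˡ Q∼Dⱼ (D-on-ℓ j))

  CD-tangent : ∀ i → Tangent KSet (CD i)
  CD-tangent i = D i , D-nz i , on₂-⊗ C (D i) , KSet-D i , only-Dᵢ
    where
    only-Dᵢ : ∀ Q → NZ Q → Q on CD i → KSet Q → Q ∼ D i
    only-Dᵢ Q Q≠0 Q-on-CD (inj₁ Q∈T , _ , Q≁Cp) = ⊥-elim (Q≁Cp i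
      (unique-meet Q≠0 (Cp≠0 i) (CD≠0 i) c-nz (CD≁c i) Q-on-CD Q-on-c (⊗-on₁ (CD i) c) (Cp-on-c i)))
      where
      Q-on-c : Q on c
      Q-on-c = Triangle-through-C⇒on-c (CD≠0 i) (on₁-⊗ C (D i))
        (separated-by-point (on₂-⊗ C (D i)) (D-off-a i)) (separated-by-point (on₂-⊗ C (D i)) (D-off-b i))
        Q≠0 Q-on-CD Q∈T
    only-Dᵢ Q Q≠0 Q-on-CD (inj₂ (j , Q∼Dⱼ) , _) =
      on-CD∩ℓ⇒∼D i Q≠0 Q-on-CD (on-respˡ Q∼Dⱼ (D-on-ℓ j))

  BD≁CD : ∀ i → ¬ BD i ∼ CD i
  BD≁CD i BD∼CD = D-off-a i (on-respʳ (∼-sym BD∼a) (on₂-⊗ B (D i)))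
    where
    BD∼a : BD i ∼ a
    BD∼a = unique-join B≠0 C≠0 (BD≠0 i) a-nz B≁C
      (on₁-⊗ B (D i)) B-on-a (on-respʳ BD∼CD (on₁-⊗ C (D i))) C-on-a

  ¬Semioval : ¬ Semioval KSet
  ¬Semioval = two-tangents⇒¬Semioval (D-nz i) (KSet-D i) (BD≠0 i) (CD≠0 i) (BD≁CD i)
    (on₂-⊗ B (D i)) (on₂-⊗ C (D i)) (BD-tangent i) (CD-tangent i)
    where i = Fin.zero

  module _ {P : V3} (P≠0 : NZ P) (P-on-b : P on b) (KP : KSet P) where

    P-off-a : ¬ P on a
    P-off-a = proj₁ (KSet-on-b⇒off-a-c KP P-on-b)

    P-off-c : ¬ P on c
    P-off-c = proj₂ (KSet-on-b⇒off-a-c KP P-on-b)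

    PB : V3
    PB = P ⊗ B

    PB≠0 : NZ PB
    PB≠0 = NZ-⊗ P≠0 B≠0 (separated-by-line B-on-a P-off-a)

    PB≁b : ¬ PB ∼ b
    PB≁b = separated-by-point (on₂-⊗ P B) B-off-b

    PB-tangent : Tangent KSet PB
    PB-tangent = P , P≠0 , on₁-⊗ P B , KP , only-P
      where
      only-P : ∀ Q → NZ Q → Q on PB → KSet Q → Q ∼ P
      only-P Q Q≠0 Q-on-PB (inj₁ Q∈T , _) =
        unique-meet Q≠0 P≠0 PB≠0 b-nz PB≁b Q-on-PB Q-on-b (on₁-⊗ P B) P-on-b
        where
        Q-on-b : Q on b
        Q-on-b = Triangle-through-B⇒on-b PB≠0 (on₂-⊗ P B)
          (separated-by-point (on₁-⊗ P B) P-off-a) (separated-by-point (on₁-⊗ P B) P-off-c)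
          Q≠0 Q-on-PB Q∈T
      only-P Q Q≠0 Q-on-PB (inj₂ (j , Q∼Dⱼ) , _) = ⊥-elim (proj₁ (proj₂ KP) j P∼Bpⱼ)
        where
        PB∼BDⱼ : PB ∼ BD j
        PB∼BDⱼ = unique-join B≠0 (D-nz j) PB≠0 (BD≠0 j) (B≁D j)
          (on₂-⊗ P B) (on₁-⊗ B (D j)) (on-respˡ (∼-sym Q∼Dⱼ) Q-on-PB) (on₂-⊗ B (D j))
        P∼Bpⱼ : P ∼ Bp j
        P∼Bpⱼ = unique-meet P≠0 (Bp≠0 j) PB≠0 b-nz PB≁b
          (on₁-⊗ P B) P-on-b (on-respʳ PB∼BDⱼ (⊗-on₁ (BD j) b)) (Bp-on-b j)

    secant-≁b : ∀ L → NZ L → P on L → ¬ L ∼ PB → ¬ L ∼ b → Secant KSet L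
    secant-≁b L L≠0 P-on-L L≁PB L≁b =
      P , X , P≠0 , X≠0 , P-on-L , ⊗-on₁ L a , KP , KSet-on-a X-on-a X-off-b X-off-c ,
      separated-by-line X-on-a P-off-a
      where
      X : V3
      X = L ⊗ a
      X≠0 : NZ X
      X≠0 = NZ-⊗ L≠0 a-nz (separated-by-point P-on-L P-off-a)
      X-on-a : X on a
      X-on-a = ⊗-on₂ L a
      X-off-b : ¬ X on b
      X-off-b X-on-b = L≁b (unique-join P≠0 C≠0 L≠0 b-nz (separated-by-line C-on-a P-off-a)
        P-on-L P-on-b (on-respˡ (∼-sym (on-a-b⇒∼C X≠0 X-on-a X-on-b)) (⊗-on₁ L a)) C-on-b)
      X-off-c : ¬ X on c
      X-off-c X-on-c = L≁PB (unique-join P≠0 B≠0 L≠0 PB≠0 (separated-by-line B-on-a P-off-a)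
        P-on-L (on₁-⊗ P B) (on-respˡ (∼-sym X∼B) (⊗-on₁ L a)) (on₂-⊗ P B))
        where
        X∼B : X ∼ B
        X∼B = unique-meet X≠0 B≠0 a-nz c-nz a≁c X-on-a X-on-c B-on-a B-on-c

    module _ (n+2<q : suc (suc (suc (suc m))) ℕ.< q) where

      excluded : Fin (suc (suc (suc (suc m)))) → V3
      excluded = P ∷ A ∷ Bp

      excluded≠0 : ∀ j → NZ (excluded j)
      excluded≠0 Fin.zero                = P≠0
      excluded≠0 (Fin.suc Fin.zero)      = A≠0
      excluded≠0 (Fin.suc (Fin.suc i))   = Bp≠0 i

      P≁C : ¬ P ∼ C
      P≁C = separated-by-line C-on-a P-off-a

      avoiding : Σ V3 λ Y → NZ Y × (∀ {L} → P on L → C on L → Y on L) × ¬ Y ∼ C ×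
                              (∀ j → ¬ Y ∼ excluded j)
      avoiding = ∃-point-avoiding P≠0 C≠0 P≁C n+2<q excluded excluded≠0

      Y : V3
      Y = proj₁ avoiding

      Y≠0 : NZ Y
      Y≠0 = proj₁ (proj₂ avoiding)

      Y-on-b : Y on b
      Y-on-b = proj₁ (proj₂ (proj₂ avoiding)) P-on-b C-on-b

      Y≁C : ¬ Y ∼ C
      Y≁C = proj₁ (proj₂ (proj₂ (proj₂ avoiding)))

      Y≁excluded : ∀ j → ¬ Y ∼ excluded j
      Y≁excluded = proj₂ (proj₂ (proj₂ (proj₂ avoiding)))

      Y-off-a : ¬ Y on a
      Y-off-a Y-on-a = Y≁C (on-a-b⇒∼C Y≠0 Y-on-a Y-on-b)

      Y-off-c : ¬ Y on c
      Y-off-c Y-on-c = Y≁excluded (Fin.suc Fin.zero) (on-b-c⇒∼A Y≠0 Y-on-b Y-on-c)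

      KY : KSet Y
      KY = KSet-on-b Y-off-a Y-on-b Y-off-c (λ i → Y≁excluded (Fin.suc (Fin.suc i)))

      P≁Y : ¬ P ∼ Y
      P≁Y P∼Y = Y≁excluded Fin.zero (∼-sym P∼Y)

      secant-∼b : ∀ L → P on L → L ∼ b → Secant KSet L
      secant-∼b L P-on-L L∼b = P , Y , P≠0 , Y≠0 , P-on-L , on-respʳ L∼b Y-on-b , KP , KY , P≁Y

      RInfty : RInftyProperty KSet P
      RInfty = tangent-and-secants⇒RInfty PB≠0 (on₁-⊗ P B) PB-tangent secant
        where
        secant : ∀ L → NZ L → P on L → ¬ L ∼ PB → Secant KSet L
        secant L L≠0 P-on-L L≁PB = by-cases (∼-dec L≠0 b-nz)
          where
          by-cases : Dec (L ∼ b) → Secant KSet L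
          by-cases (yes L∼b) = secant-∼b L P-on-L L∼b
          by-cases (no  L≁b) = secant-≁b L L≠0 P-on-L L≁PB L≁b

  ∃-RInfty-point : BlockingSet KSet → suc (suc (suc (suc m))) ℕ.< q →
                   Σ V3 λ P → NZ P × KSet P × RInftyProperty KSet P
  ∃-RInfty-point (meets-every-line , _) n+2<q with meets-every-line b b-nz
  ... | P , P≠0 , P-on-b , KP = P , P≠0 , KP , RInfty P≠0 P-on-b KP n+2<q

-- Imported only now: inside the modules above, _+_ and _*_ are the field operations.
open import Data.Nat using (_+_; _*_; _≤_; _<_)
open import Data.Nat.Properties using (+-cancelˡ-≤; +-monoˡ-≤; +-comm; +-assoc; module ≤-Reasoning)
open import Data.Nat.Tactic.RingSolver using (solve-∀)

k≥2q⇒2+n<q : ∀ {q k n} → k + n + 3 ≡ 3 * q → 2 * q ≤ k → 2 + n < q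
k≥2q⇒2+n<q {q} {k} {n} k+n+3≡3q 2q≤k = +-cancelˡ-≤ (2 * q) (3 + n) q (begin
  2 * q + (3 + n)  ≤⟨ +-monoˡ-≤ (3 + n) 2q≤k ⟩
  k + (3 + n)      ≡⟨ cong (λ x → k + x) (+-comm 3 n) ⟩
  k + (n + 3)      ≡⟨ +-assoc k n 3 ⟨
  k + n + 3        ≡⟨ k+n+3≡3q ⟩
  3 * q            ≡⟨ 3q≡2q+q q ⟩
  2 * q + q        ∎)
  where
  open ≤-Reasoning
  3q≡2q+q : ∀ q → 3 * q ≡ 2 * q + q
  3q≡2q+q = solve-∀

lemma3p8 : (q : ℕ) → 5 ≤ q → IsPrimePower q → (F : FiniteField q) →
    (k m : ℕ) → (K : PG.KData F m) →
    k + suc (suc m) + 3 ≡ 3 * q → 2 * q ≤ k → k + 5 ≤ 3 * q →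
    PG.MinimalBlockingSet F (PG.KData.KSet K) →
    Σ (PG.V3 F) (λ P → PG.NZ F P × PG.KData.KSet K P ×
      PG.RInftyProperty F (PG.KData.KSet K) P) ×
    ¬ (PG.BlockingSemioval F (PG.KData.KSet K))
lemma3p8 q _ _ F k m K k+n+3≡3q 2q≤k _ (blocking , _) =
  ∃-RInfty-point blocking (k≥2q⇒2+n<q k+n+3≡3q 2q≤k) , ¬Semioval ∘ proj₂
  where open KConstruction F K
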